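{- Suppose the input graph $G$ is a tree, revealed in an admissible order $v_1,\dots,v_n$, and $2$-DOMINATE is run on it, with charges $ch$ defined as in the context. Then for every vertex $v_i$, at most one vertex of $N[v_i]$ has charge equal to $1$.
   Context: Online dominating set model: a finite connected simple undirected graph $G$ is revealed in an order $v_1,\dots,v_n$ such that for every $i$ the subgraph induced on $\{v_1,\dots,v_i\}$ is connected; at step $i$, $v_i$ is revealed together with its entire closed neighbourhood $N[v_i]$, and the algorithm irrevocably decides whether to select $v_i$. Notation: $R_i=\{v_1,\dots,v_i\}$, $V_i=N[R_i]$; $S_i$ = vertices among $v_1,\dots,v_i$ selected, $S_0=\emptyset$; $D_i=N[S_i]$; $U_i=V_i\setminus D_{i-1}$. $v_j$ saves $v_i$ if $j=\max\{k: v_k\in N[v_i]\}$ and $N[v_i]\setminus\{v_j\}$ contains no vertex of $S_{j-1}$; $s(v_j)$ is the set of vertices saved by $v_j$. The algorithm $k$-DOMINATE selects $v_i$ iff $|N(v_i)\cap U_i|\ge k$ or $|s(v_i)|\ge1$. Charges: for each selected vertex $v_i$ let $X_i=N[v_i]\cap U_i$ (the vertices newly dominated by selecting $v_i$); every vertex $v$ of $G$ belongs to exactly one such $X_i$, and its charge is $ch(v)=1/|X_i|$. -}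

module Defs where

open import Data.Bool using (Bool; true; false; _∧_; _∨_; not; if_then_else_; T)
open import Data.Nat using (ℕ; zero; suc; _≤_; _≤ᵇ_; _<ᵇ_; _≡ᵇ_)
open import Data.Fin using (Fin; toℕ; _≟_)
open import Data.List using (List; []; _∷_; _++_; length; map; findᵇ; allFin)
open import Data.Bool.ListAction using (any)
open import Data.Nat.ListAction using (sum)
open import Data.List.Relation.Unary.Unique.Propositional using (Unique)
open import Data.Maybe using (Maybe; just; nothing)
open import Data.Product using (_×_)
open import Data.Unit using (⊤)
open import Data.Integer using (+_)
open import Data.Rational using (ℚ; 0ℚ; _/_)
open import Relation.Nullary using (¬_; ⌊_⌋)
open import Relation.Binary.PropositionalEquality using (_≡_)

-- A finite simple undirected graph on vertex set Fin n.
-- Vertices are named by their position in the reveal order: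
-- vertex i (0-based) is v_{i+1} of the paper.
record Graph (n : ℕ) : Set where
  field
    adj    : Fin n → Fin n → Bool
    sym    : ∀ u v → adj u v ≡ adj v u
    irrefl : ∀ v → adj v v ≡ false
open Graph public

data WalkIn {n : ℕ} (G : Graph n) (P : Fin n → Set) : Fin n → Fin n → Set where
  nil  : ∀ {u} → P u → WalkIn G P u u
  cons : ∀ {u v w} → P u → T (adj G u v) → WalkIn G P v w → WalkIn G P u w

Connected : ∀ {n} → Graph n → Set
Connected G = ∀ u v → WalkIn G (λ _ → ⊤) u v

Chain : ∀ {n} → Graph n → List (Fin n) → Set
Chain G []           = ⊤
Chain G (x ∷ [])     = ⊤
Chain G (x ∷ y ∷ xs) = T (adj G x y) × Chain G (y ∷ xs)

Acyclic : ∀ {n} → Graph n → Set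
Acyclic G = ∀ x xs → 2 ≤ length xs → Unique {A = Fin _} (x ∷ xs) → ¬ Chain G (x ∷ xs ++ x ∷ [])

IsTree : ∀ {n} → Graph n → Set
IsTree G = Connected G × Acyclic G

-- The identity order (vertex 0, 1, …, n-1) is admissible: every prefix
-- R_i = {0,…,i} induces a connected subgraph.
Admissible : ∀ {n} → Graph n → Set
Admissible {n} G = ∀ (i u w : Fin n) → toℕ u ≤ toℕ i → toℕ w ≤ toℕ i →
               WalkIn G (λ x → toℕ x ≤ toℕ i) u w

-- 1/k as a rational (k = 0 never occurs for charges; it is sent to 0)
recip : ℕ → ℚ
recip zero    = 0ℚ
recip (suc m) = (+ 1) / suc m

module Dominate {n : ℕ} (G : Graph n) (k : ℕ) where

  anyF : (Fin n → Bool) → Bool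
  anyF p = any p (allFin n)

  countF : (Fin n → Bool) → ℕ
  countF p = sum (map (λ x → if p x then 1 else 0) (allFin n))

  closedN : Fin n → Fin n → Bool
  closedN u v = ⌊ u ≟ v ⌋ ∨ adj G u v

  _≤ᶠ_ _<ᶠ_ : Fin n → Fin n → Bool
  u ≤ᶠ v = toℕ u ≤ᵇ toℕ v
  u <ᶠ v = toℕ u <ᵇ toℕ v

  -- In the following, S is the characteristic function of the set of
  -- selected vertices among those revealed before the current step.

  inV : Fin n → Fin n → Bool
  inV i v = anyF (λ j → (j ≤ᶠ i) ∧ closedN j v)

  inD : (Fin n → Bool) → Fin n → Fin n → Bool
  inD S i v = anyF (λ j → (j <ᶠ i) ∧ S j ∧ closedN j v)

  inU : (Fin n → Bool) → Fin n → Fin n → Bool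
  inU S i v = inV i v ∧ not (inD S i v)

  saves : (Fin n → Bool) → Fin n → Fin n → Bool
  saves S j v =
    (closedN v j ∧ not (anyF (λ m → (j <ᶠ m) ∧ closedN v m)))
    ∧ not (anyF (λ w → closedN v w ∧ not ⌊ w ≟ j ⌋ ∧ (w <ᶠ j) ∧ S w))

  decide : (Fin n → Bool) → Fin n → Bool
  decide S i = (k ≤ᵇ countF (λ u → adj G i u ∧ inU S i u)) ∨ anyF (saves S i)

  -- S_m : selected vertices among the first m revealed ones
  selUpTo : ℕ → Fin n → Bool
  selUpTo zero    v = false
  selUpTo (suc m) v = if toℕ v ≡ᵇ m then decide (selUpTo m) v else selUpTo m v

  sel : Fin n → Bool
  sel i = decide (selUpTo (toℕ i)) i

  inX : Fin n → Fin n → Bool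
  inX i v = sel i ∧ closedN i v ∧ inU (selUpTo (toℕ i)) i v

  -- the (unique) selected vertex v_i with v ∈ X_i
  owner : Fin n → Maybe (Fin n)
  owner v = findᵇ (λ i → inX i v) (allFin n)

  ch : Fin n → ℚ
  ch v with owner v
  ... | just i  = recip (countF (inX i))
  ... | nothing = 0ℚ

-- If ch(u) = 1 then u is the only vertex newly dominated by its owner a. Since k ≥ 2, a cannot
-- have been selected for having k undominated neighbours, so a saves some vertex, and every vertex
-- saved by a is newly dominated by a: a saves u. Moreover a = u, for otherwise a (the last vertex
-- of N[u]) was already dominated by an earlier selected j; in an admissible order of a tree a has
-- at most one earlier neighbour, so j = u, contradicting that a saves u.
-- Hence u saves itself: u is the last vertex of N[u] and no neighbour of u is ever selected. Two
-- such vertices cannot be adjacent (each would come after the other), nor share a neighbour c: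
-- c precedes both, so at step c both are undominated neighbours of c and, as k ≤ 2, c is selected.

module Submission where

open import Defs
open import Data.Bool using (Bool; true; false; T; not; _∧_; if_then_else_)
open import Data.Bool.Properties using (T-∧; T-∨)
open import Data.Empty using (⊥-elim)
open import Data.Fin as Fin using (Fin; toℕ; zero; suc; inject₁)
open import Data.Fin.Properties using (toℕ-injective; toℕ-inject₁; <⇒≢)
open import Data.List using (List; []; _∷_; _++_; length; map; allFin; findᵇ)
open import Data.List.Membership.Propositional using (_∈_; lose)
open import Data.List.Membership.Propositional.Properties using (∈-allFin)
open import Data.List.Relation.Unary.All as All using (All; []; _∷_)
open import Data.List.Relation.Unary.All.Properties using (¬Any⇒All¬)
open import Data.List.Relation.Unary.Any using (here; there; satisfied)
open import Data.List.Relation.Unary.Any.Properties using (any⁺; any⁻)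
open import Data.List.Relation.Unary.AllPairs using ([]; _∷_)
open import Data.List.Relation.Unary.Unique.Propositional using (Unique)
open import Data.List.Relation.Unary.Unique.Propositional.Properties using (allFin⁺)
open import Data.Maybe using (just; nothing)
open import Data.Maybe.Properties using (just-injective)
open import Data.Nat using (ℕ; zero; suc; _≤_; _<_; _≤ᵇ_; _≡ᵇ_; z≤n; s≤s; s≤s⁻¹)
open import Data.Nat.ListAction using (sum)
open import Data.Nat.Properties
  using (≤-refl; ≤-trans; ≤-reflexive; <-irrefl; <-asym; 1+n≰n; ≮⇒≥; ≤∧≢⇒<; m≤n+m;
         ≤ᵇ⇒≤; ≤⇒≤ᵇ; <ᵇ⇒<; <⇒<ᵇ; ≡ᵇ⇒≡; ≡⇒≡ᵇ; *-identityˡ)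
open import Data.Product using (∃; _×_; _,_; proj₁)
open import Data.Rational using (1ℚ)
open import Data.Rational.Properties using (normalize-injective-≃; 1≢0)
open import Data.Sum as Sum using (_⊎_; inj₁; inj₂)
open import Data.Unit using (tt)
open import Function using (_∘_; Equivalence)
open import Relation.Nullary using (¬_; yes; no; T?; ⌊_⌋)
open import Relation.Nullary.Decidable using (toWitness)
open import Relation.Binary.PropositionalEquality using (_≡_; _≢_; refl; cong; subst)
import Relation.Binary.PropositionalEquality as ≡

open Equivalence using (to; from)

not⁺ : ∀ {b} → ¬ T b → T (not b)
not⁺ {false} _   = tt
not⁺ {true}  ¬tt = ¬tt tt

not⁻ : ∀ {b} → T (not b) → ¬ T b
not⁻ {false} _ ()

countᵇ : ∀ {A : Set} → (A → Bool) → List A → ℕ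
countᵇ p xs = sum (map (λ x → if p x then 1 else 0) xs)

module _ {A : Set} (p : A → Bool) where

  countᵇ-≥1 : ∀ {x xs} → x ∈ xs → T (p x) → 1 ≤ countᵇ p xs
  countᵇ-≥1 {x} (here refl) px with p x
  ... | true = s≤s z≤n
  countᵇ-≥1 {xs = y ∷ _} (there x∈) px = ≤-trans (countᵇ-≥1 x∈ px) (m≤n+m _ _)

  countᵇ-≥2 : ∀ {x y xs} → x ∈ xs → y ∈ xs → x ≢ y → T (p x) → T (p y) → 2 ≤ countᵇ p xs
  countᵇ-≥2 (here refl) (here refl) x≢y _ _ = ⊥-elim (x≢y refl)
  countᵇ-≥2 {x} (here refl) (there y∈) _ px py with p x
  ... | true = s≤s (countᵇ-≥1 y∈ py)
  countᵇ-≥2 {y = y} (there x∈) (here refl) _ px py with p y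
  ... | true = s≤s (countᵇ-≥1 x∈ px)
  countᵇ-≥2 {xs = z ∷ _} (there x∈) (there y∈) x≢y px py =
    ≤-trans (countᵇ-≥2 x∈ y∈ x≢y px py) (m≤n+m _ _)

  countᵇ-≡0 : ∀ {xs} → All (λ x → ¬ T (p x)) xs → countᵇ p xs ≡ 0
  countᵇ-≡0 [] = refl
  countᵇ-≡0 {y ∷ _} (¬py ∷ rest) with p y
  ... | false = countᵇ-≡0 rest
  ... | true  = ⊥-elim (¬py tt)

  countᵇ-≤1 : ∀ {u xs} → Unique xs → (∀ {x} → T (p x) → x ≡ u) → countᵇ p xs ≤ 1
  countᵇ-≤1 [] _ = z≤n
  countᵇ-≤1 {xs = y ∷ _} (y∉ys ∷ uniq) only-u with p y in py
  ... | false = countᵇ-≤1 uniq only-u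
  ... | true  = ≤-reflexive (cong suc (countᵇ-≡0 (All.map y≢x⇒¬px y∉ys)))
    where
    y≢x⇒¬px : ∀ {x} → y ≢ x → ¬ T (p x)
    y≢x⇒¬px y≢x px = y≢x (≡.trans (only-u (subst T (≡.sym py) tt)) (≡.sym (only-u px)))

findᵇ-sound : ∀ {A : Set} (p : A → Bool) xs {x} → findᵇ p xs ≡ just x → T (p x)
findᵇ-sound p (y ∷ ys) found with p y in py
... | true  = subst (T ∘ p) (just-injective found) (subst T (≡.sym py) tt)
... | false = findᵇ-sound p ys found

recip≡1⇒≡1 : ∀ m → recip m ≡ 1ℚ → m ≡ 1
recip≡1⇒≡1 zero    ()
recip≡1⇒≡1 (suc m) eq =
  ≡.trans (≡.sym (*-identityˡ (suc m))) (≡.sym (normalize-injective-≃ 1 1 (suc m) 1 eq))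

WalkIn-map : ∀ {n} {G : Graph n} {P Q : Fin n → Set} → (∀ {x} → P x → Q x) →
             ∀ {u v} → WalkIn G P u v → WalkIn G Q u v
WalkIn-map f (nil pu)        = nil (f pu)
WalkIn-map f (cons pu uv vw) = cons (f pu) uv (WalkIn-map f vw)

Admissible⇒walkBefore : ∀ {n} {G : Graph n} → Admissible G → ∀ {a u v : Fin n} →
                        toℕ u < toℕ a → toℕ v < toℕ a → WalkIn G (λ x → toℕ x < toℕ a) u v
Admissible⇒walkBefore admissible {zero}  () _
Admissible⇒walkBefore admissible {suc a} {u} {v} u<a v<a =
  WalkIn-map (λ x≤a → s≤s (subst (_ ≤_) (toℕ-inject₁ a) x≤a))
    (admissible (inject₁ a) u v (below u<a) (below v<a))
  where
  below : ∀ {x} → toℕ x < suc (toℕ a) → toℕ x ≤ toℕ (inject₁ a)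
  below x<a = subst (_ ≤_) (≡.sym (toℕ-inject₁ a)) (s≤s⁻¹ x<a)

module _ {n : ℕ} (G : Graph n) where

  open import Data.List.Membership.DecPropositional (Fin._≟_ {n}) using (_∈?_)

  adj-sym : ∀ {u v} → T (adj G u v) → T (adj G v u)
  adj-sym {u} {v} = subst T (sym G u v)

  adj⇒≢ : ∀ {u v} → T (adj G u v) → u ≢ v
  adj⇒≢ {u} uv refl = subst T (irrefl G u) uv

  data Walk : Fin n → Fin n → List (Fin n) → Set where
    stop : ∀ {u} → Walk u u (u ∷ [])
    step : ∀ {u v w xs} → T (adj G u v) → Walk v w xs → Walk u w (u ∷ xs)

  Path : (Fin n → Set) → Fin n → Fin n → Set
  Path P u v = ∃ λ xs → Walk u v xs × Unique xs × All P xs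

  Path-from : ∀ {P u v x xs} → x ∈ xs → Walk u v xs → Unique xs → All P xs → Path P x v
  Path-from (here refl) stop           uq       ps       = _ , stop , uq , ps
  Path-from (here refl) (step uv walk) uq       ps       = _ , step uv walk , uq , ps
  Path-from (there x∈)  (step _ walk)  (_ ∷ uq) (_ ∷ ps) = Path-from x∈ walk uq ps

  WalkIn⇒Path : ∀ {P u v} → WalkIn G P u v → Path P u v
  WalkIn⇒Path (nil pu) = _ , stop , [] ∷ [] , pu ∷ []
  WalkIn⇒Path {u = u} (cons pu uv vw) with WalkIn⇒Path vw
  ... | xs , walk , uq , ps with u ∈? xs
  ...   | yes u∈xs = Path-from u∈xs walk uq ps
  ...   | no  u∉xs = u ∷ xs , step uv walk , ¬Any⇒All¬ xs u∉xs ∷ uq , pu ∷ ps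

  Walk-length≥2 : ∀ {u v xs} → Walk u v xs → u ≢ v → 2 ≤ length xs
  Walk-length≥2 stop                u≢v = ⊥-elim (u≢v refl)
  Walk-length≥2 (step _ stop)       _   = s≤s (s≤s z≤n)
  Walk-length≥2 (step _ (step _ _)) _   = s≤s (s≤s z≤n)

  Walk-chain : ∀ {u v a b xs} → Walk u v xs → T (adj G a u) → T (adj G v b) →
               Chain G (a ∷ xs ++ b ∷ [])
  Walk-chain stop         au vb = au , vb , tt
  Walk-chain (step uv vw) au vb = au , Walk-chain vw uv vb

  Acyclic⇒noDetour : Acyclic G → ∀ {P a u v} → (∀ {x} → P x → a ≢ x) →
                     T (adj G a u) → T (adj G v a) → u ≢ v → ¬ WalkIn G P u v
  Acyclic⇒noDetour acyclic avoids-a au va u≢v uv with WalkIn⇒Path uv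
  ... | xs , walk , uq , ps =
    acyclic _ xs (Walk-length≥2 walk u≢v) (All.map avoids-a ps ∷ uq) (Walk-chain walk au va)

  earlierNeighbour-unique : Acyclic G → Admissible G → ∀ {a u v} →
    T (adj G u a) → T (adj G v a) → toℕ u < toℕ a → toℕ v < toℕ a → u ≡ v
  earlierNeighbour-unique acyclic admissible {a} {u} {v} ua va u<a v<a with u Fin.≟ v
  ... | yes u≡v = u≡v
  ... | no  u≢v = ⊥-elim (Acyclic⇒noDetour acyclic a≢earlier (adj-sym ua) va u≢v
                            (Admissible⇒walkBefore admissible u<a v<a))
    where
    a≢earlier : ∀ {x} → toℕ x < toℕ a → a ≢ x
    a≢earlier x<a refl = <-irrefl refl x<a

module _ {n : ℕ} (G : Graph n) (k : ℕ) where
  open Dominate G k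

  closedN⁻ : ∀ {u v} → T (closedN u v) → u ≡ v ⊎ T (adj G u v)
  closedN⁻ {u} {v} c with u Fin.≟ v
  ... | yes u≡v = inj₁ u≡v
  ... | no  _   = inj₂ c

  closedN-refl : ∀ u → T (closedN u u)
  closedN-refl u with u Fin.≟ u
  ... | yes _   = tt
  ... | no  u≢u = ⊥-elim (u≢u refl)

  adj⇒closedN : ∀ {u v} → T (adj G u v) → T (closedN u v)
  adj⇒closedN {u} {v} = from (T-∨ {⌊ u Fin.≟ v ⌋}) ∘ inj₂

  closedN-sym : ∀ {u v} → T (closedN u v) → T (closedN v u)
  closedN-sym {u} c with closedN⁻ c
  ... | inj₁ refl = closedN-refl u
  ... | inj₂ uv   = adj⇒closedN (adj-sym G uv)

  closedN∧≢⇒adj : ∀ {u v} → T (closedN u v) → u ≢ v → T (adj G u v)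
  closedN∧≢⇒adj c u≢v with closedN⁻ c
  ... | inj₁ u≡v = ⊥-elim (u≢v u≡v)
  ... | inj₂ uv  = uv

  anyF⁻ : ∀ p → T (anyF p) → ∃ (T ∘ p)
  anyF⁻ p = satisfied ∘ any⁻ p (allFin n)

  anyF⁺ : ∀ p {x} → T (p x) → T (anyF p)
  anyF⁺ p px = any⁺ p (lose (∈-allFin _) px)

  inD⁻ : ∀ {S i v} → T (inD S i v) → ∃ λ j → toℕ j < toℕ i × T (S j) × T (closedN j v)
  inD⁻ {S} {i} {v} d with anyF⁻ (λ j → (j <ᶠ i) ∧ S j ∧ closedN j v) d
  ... | j , q with to (T-∧ {j <ᶠ i}) q
  ...   | j<i , q′ with to (T-∧ {S j}) q′
  ...     | sj , cjv = j , <ᵇ⇒< _ _ j<i , sj , cjv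

  closedN⇒inV : ∀ {i v} → T (closedN i v) → T (inV i v)
  closedN⇒inV {i} {v} c =
    anyF⁺ (λ j → (j ≤ᶠ i) ∧ closedN j v) {i} (from (T-∧ {i ≤ᶠ i}) (≤⇒≤ᵇ (≤-refl {toℕ i}) , c))

  inU⁺ : ∀ {S i v} → T (closedN i v) → ¬ T (inD S i v) → T (inU S i v)
  inU⁺ {S} {i} {v} c ¬d = from (T-∧ {inV i v}) (closedN⇒inV c , not⁺ ¬d)

  inX⁺ : ∀ {i v} → T (sel i) → T (closedN i v) → ¬ T (inD (selUpTo (toℕ i)) i v) → T (inX i v)
  inX⁺ {i} {v} si c ¬d = from (T-∧ {sel i}) (si , from (T-∧ {closedN i v}) (c , inU⁺ c ¬d))

  inX⇒sel : ∀ {i v} → T (inX i v) → T (sel i)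
  inX⇒sel {i} = proj₁ ∘ to (T-∧ {sel i})

  owner⇒inX : ∀ {v i} → owner v ≡ just i → T (inX i v)
  owner⇒inX {v} = findᵇ-sound (λ i → inX i v) (allFin n)

  record Saves (S : Fin n → Bool) (j v : Fin n) : Set where
    field
      near       : T (closedN v j)
      latest     : ∀ {m} → T (closedN v m) → toℕ m ≤ toℕ j
      unselected : ∀ {w} → T (closedN v w) → w ≢ j → toℕ w < toℕ j → ¬ T (S w)

  saves⁻ : ∀ {S j v} → T (saves S j v) → Saves S j v
  saves⁻ {S} {j} {v} s
    with to (T-∧ {closedN v j ∧ not (anyF (λ m → (j <ᶠ m) ∧ closedN v m))}) s
  ... | s₁₂ , s₃ with to (T-∧ {closedN v j}) s₁₂
  ...   | c , s₂ = record { near = c ; latest = latest ; unselected = unselected }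
    where
    latest : ∀ {m} → T (closedN v m) → toℕ m ≤ toℕ j
    latest {m} c′ = ≮⇒≥ λ j<m →
      not⁻ s₂ (anyF⁺ (λ m → (j <ᶠ m) ∧ closedN v m) {m} (from (T-∧ {j <ᶠ m}) (<⇒<ᵇ j<m , c′)))

    unselected : ∀ {w} → T (closedN v w) → w ≢ j → toℕ w < toℕ j → ¬ T (S w)
    unselected {w} c′ w≢j w<j sw =
      not⁻ s₃ (anyF⁺ (λ w → closedN v w ∧ not ⌊ w Fin.≟ j ⌋ ∧ (w <ᶠ j) ∧ S w) {w}
        (from (T-∧ {closedN v w}) (c′ , from (T-∧ {not ⌊ w Fin.≟ j ⌋})
          (not⁺ (w≢j ∘ toWitness {a? = w Fin.≟ j}) , from (T-∧ {w <ᶠ j}) (<⇒<ᵇ w<j , sw)))))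

  inNU : (Fin n → Bool) → Fin n → Fin n → Bool
  inNU S i u = adj G i u ∧ inU S i u

  decide⁻ : ∀ {S i} → T (decide S i) → k ≤ countF (inNU S i) ⊎ ∃ (T ∘ saves S i)
  decide⁻ {S} {i} = Sum.map (≤ᵇ⇒≤ _ _) (anyF⁻ (saves S i)) ∘ to (T-∨ {k ≤ᵇ countF (inNU S i)})

  decide⁺ : ∀ {S i} → k ≤ countF (inNU S i) → T (decide S i)
  decide⁺ {S} {i} = from (T-∨ {k ≤ᵇ countF (inNU S i)}) ∘ inj₁ ∘ ≤⇒≤ᵇ

  selUpTo≡sel : ∀ m {v} → toℕ v < m → selUpTo m v ≡ sel v
  selUpTo≡sel (suc m) {v} v<1+m with toℕ v ≡ᵇ m in v≟m
  ... | true  = cong (λ l → decide (selUpTo l) v) (≡.sym (≡ᵇ⇒≡ (toℕ v) m (subst T (≡.sym v≟m) tt)))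
  ... | false = selUpTo≡sel m (≤∧≢⇒< (s≤s⁻¹ v<1+m) (λ v≡m → subst T v≟m (≡⇒≡ᵇ (toℕ v) m v≡m)))

  inNU⇒inX : ∀ {i v} → T (sel i) → T (inNU (selUpTo (toℕ i)) i v) → T (inX i v)
  inNU⇒inX {i} {v} si new with to (T-∧ {adj G i v}) new
  ... | iv , u = from (T-∧ {sel i}) (si , from (T-∧ {closedN i v}) (adj⇒closedN iv , u))

  saved⇒inX : ∀ {a x} → T (sel a) → T (saves (selUpTo (toℕ a)) a x) → T (inX a x)
  saved⇒inX {a} {x} sa s = inX⁺ sa (closedN-sym (Saves.near s′)) undominated
    where
    s′ = saves⁻ s
    undominated : ¬ T (inD (selUpTo (toℕ a)) a x)
    undominated d with inD⁻ d
    ... | j , j<a , sj , cjx = Saves.unselected s′ (closedN-sym cjx) (<⇒≢ j<a) j<a sj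

  saves⇒earlierNeighbour : ∀ {S j v} → T (saves S j v) → v ≢ j → T (adj G v j) × toℕ v < toℕ j
  saves⇒earlierNeighbour {v = v} s v≢j =
    closedN∧≢⇒adj (Saves.near s′) v≢j , ≤∧≢⇒< (Saves.latest s′ (closedN-refl v)) (v≢j ∘ toℕ-injective)
    where s′ = saves⁻ s

  ch≡1⇒soleMember : ∀ {u} → ch u ≡ 1ℚ → ∃ λ a → T (inX a u) × (∀ {v} → T (inX a v) → v ≡ u)
  ch≡1⇒soleMember {u} ch≡1 with owner u in owns
  ... | nothing = ⊥-elim (1≢0 (≡.sym ch≡1))
  ... | just a  = a , owner⇒inX owns , sole
    where
    sole : ∀ {v} → T (inX a v) → v ≡ u
    sole {v} xv with v Fin.≟ u
    ... | yes v≡u = v≡u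
    ... | no  v≢u = ⊥-elim (1+n≰n (subst (2 ≤_) (recip≡1⇒≡1 _ ch≡1)
                      (countᵇ-≥2 (inX a) (∈-allFin v) (∈-allFin u) v≢u xv (owner⇒inX owns))))

  soleMember⇒saved : 2 ≤ k → ∀ {a u} → T (inX a u) → (∀ {v} → T (inX a v) → v ≡ u) →
                     T (saves (selUpTo (toℕ a)) a u)
  soleMember⇒saved 2≤k {a} {u} xu sole =
    Sum.[ (λ k≤count → ⊥-elim (1+n≰n (≤-trans 2≤k (≤-trans k≤count count≤1))))
        , (λ (x , s) → subst (T ∘ saves _ a) (sole (saved⇒inX sa s)) s)
        ]′ (decide⁻ sa)
    where
    sa : T (sel a)
    sa = inX⇒sel {v = u} xu
    count≤1 : countF (inNU (selUpTo (toℕ a)) a) ≤ 1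
    count≤1 = countᵇ-≤1 (inNU _ a) (allFin⁺ n) (sole ∘ inNU⇒inX sa)

  soleSaver≡saved : Acyclic G → Admissible G → ∀ {a u} → T (inX a u) →
                    (∀ {v} → T (inX a v) → v ≡ u) → T (saves (selUpTo (toℕ a)) a u) → a ≡ u
  soleSaver≡saved acyclic admissible {a} {u} xu sole s with T? (inD (selUpTo (toℕ a)) a a)
  ... | no ¬d = sole (inX⁺ (inX⇒sel {v = u} xu) (closedN-refl a) ¬d)
  ... | yes d with inD⁻ {selUpTo (toℕ a)} {a} {a} d
  ...   | j , j<a , sj , cja = ⊥-elim (Saves.unselected (saves⁻ s) uj (<⇒≢ j<a) j<a sj)
    where
    uj : T (closedN u j)
    uj with a Fin.≟ u
    ... | yes refl = closedN-sym cja
    ... | no  a≢u with saves⇒earlierNeighbour s (a≢u ∘ ≡.sym)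
    ...   | ua , u<a
            with earlierNeighbour-unique G acyclic admissible ua (closedN∧≢⇒adj cja (<⇒≢ j<a)) u<a j<a
    ...     | refl = closedN-refl u

  SavesItself : Fin n → Set
  SavesItself u = T (saves (selUpTo (toℕ u)) u u)

  ch≡1⇒savesItself : 2 ≤ k → Acyclic G → Admissible G → ∀ {u} → ch u ≡ 1ℚ → SavesItself u
  ch≡1⇒savesItself 2≤k acyclic admissible ch≡1 with ch≡1⇒soleMember ch≡1
  ... | a , xu , sole with soleMember⇒saved 2≤k xu sole
  ...   | s with soleSaver≡saved acyclic admissible xu sole s
  ...     | refl = s

  savesItself-neighbour< : ∀ {u c} → SavesItself u → T (adj G c u) → toℕ c < toℕ u
  savesItself-neighbour< su cu =
    ≤∧≢⇒< (Saves.latest (saves⁻ su) (adj⇒closedN (adj-sym G cu))) (adj⇒≢ G cu ∘ toℕ-injective)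

  savesItself-neighbour-unselected : ∀ {u c} → SavesItself u → T (adj G c u) → ¬ T (sel c)
  savesItself-neighbour-unselected su cu sc =
    Saves.unselected (saves⁻ su) (adj⇒closedN (adj-sym G cu)) (adj⇒≢ G cu) c<u
      (subst T (≡.sym (selUpTo≡sel _ c<u)) sc)
    where c<u = savesItself-neighbour< su cu

  savesItself-nonadjacent : ∀ {u w} → SavesItself u → SavesItself w → ¬ T (adj G u w)
  savesItself-nonadjacent su sw uw =
    <-asym (savesItself-neighbour< sw uw) (savesItself-neighbour< su (adj-sym G uw))

  savesItself⇒undominated : ∀ {x c} → SavesItself x → toℕ c < toℕ x →
                            ¬ T (inD (selUpTo (toℕ c)) c x)
  savesItself⇒undominated {x} sx c<x d with inD⁻ d
  ... | j , j<c , sj , cjx =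
    savesItself-neighbour-unselected sx (closedN∧≢⇒adj cjx j≢x) (subst T (selUpTo≡sel _ j<c) sj)
    where
    j≢x : j ≢ x
    j≢x refl = <-asym j<c c<x

  twoSelfSavers⇒selected : k ≤ 2 → ∀ {u w c} → SavesItself u → SavesItself w → u ≢ w →
                           T (adj G c u) → T (adj G c w) → T (sel c)
  twoSelfSavers⇒selected k≤2 {u} {w} {c} su sw u≢w cu cw =
    decide⁺ (≤-trans k≤2 (countᵇ-≥2 (inNU _ c) (∈-allFin u) (∈-allFin w) u≢w (new su cu) (new sw cw)))
    where
    new : ∀ {x} → SavesItself x → T (adj G c x) → T (inNU (selUpTo (toℕ c)) c x)
    new {x} sx cx = from (T-∧ {adj G c x})
      (cx , inU⁺ (adj⇒closedN cx) (savesItself⇒undominated sx (savesItself-neighbour< sx cx)))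

  savesItself-commonClosedNeighbour : k ≤ 2 → ∀ {u w c} → SavesItself u → SavesItself w →
                                      T (closedN c u) → T (closedN c w) → u ≡ w
  savesItself-commonClosedNeighbour k≤2 {u} {w} su sw cu cw with closedN⁻ cu | closedN⁻ cw
  ... | inj₁ refl | inj₁ refl = refl
  ... | inj₁ refl | inj₂ uw   = ⊥-elim (savesItself-nonadjacent su sw uw)
  ... | inj₂ wu   | inj₁ refl = ⊥-elim (savesItself-nonadjacent sw su wu)
  ... | inj₂ cu′  | inj₂ cw′  with u Fin.≟ w
  ...   | yes u≡w = u≡w
  ...   | no  u≢w = ⊥-elim (savesItself-neighbour-unselected su cu′
                              (twoSelfSavers⇒selected k≤2 su sw u≢w cu′ cw′))

corollary2 : ∀ {n : ℕ} (G : Graph n) → IsTree G → Admissible G →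
    ∀ (i u w : Fin n) →
    T (Dominate.closedN G 2 i u) → T (Dominate.closedN G 2 i w) →
    Dominate.ch G 2 u ≡ 1ℚ → Dominate.ch G 2 w ≡ 1ℚ → u ≡ w
corollary2 G (_ , acyclic) admissible i u w iu iw chu≡1 chw≡1 =
  savesItself-commonClosedNeighbour G 2 ≤-refl (savesItself chu≡1) (savesItself chw≡1) iu iw
  where
  savesItself : ∀ {v} → Dominate.ch G 2 v ≡ 1ℚ → SavesItself G 2 v
  savesItself = ch≡1⇒savesItself G 2 ≤-refl acyclic admissible
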